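{- Let $\mathfrak{F}=(X,\upharpoonleft,Y,T)$ be an implicative frame. Then for all stable sets $A,C,A_i,C_j\in\mathcal{G}(X)$ ($i\in I$, $j\in J$): (1) $\left(\bigvee_{i\in I}A_i\right)\Rightarrow\left(\bigcap_{j\in J}C_j\right)=\bigcap_{i\in I,j\in J}(A_i\Rightarrow C_j)$; (2) $A\Rightarrow C=\bigcap_{x\in A,\ C\upharpoonleft y}(\Gamma x\Rightarrow{}^{\perp}\{y\})$, the intersection ranging over $x\in A$ and $y\in Y$ with $C\upharpoonleft y$; (3) for all $u,x\in X$ and $y\in Y$: $uT'xy$ iff $u\in(\Gamma x\Rightarrow{}^{\perp}\{y\})$; (4) $u\in(A\Rightarrow C)$ iff for all $x\in X$ and $y\in Y$, if $x\in A$ and $C\upharpoonleft y$ then $uT'xy$; (5) $A\subseteq C$ iff $X\subseteq A\Rightarrow C$.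
   Context: A sorted frame (polarity) is a triple $(X,\upharpoonleft,Y)$ with $X,Y$ nonempty sets and ${\upharpoonleft}\subseteq X\times Y$. For $U\subseteq X$, $V\subseteq Y$ let $U^{\perp}=\{y\in Y:\forall x\in U\ x\upharpoonleft y\}$ and ${}^{\perp}V=\{x\in X:\forall y\in V\ x\upharpoonleft y\}$. $A\subseteq X$ is stable if $A={}^{\perp}(A^{\perp})$, $B\subseteq Y$ is co-stable if $B=({}^{\perp}B)^{\perp}$; both are called Galois sets. $\mathcal{G}(X)$ and $\mathcal{G}(Y)$ are the complete lattices of stable, resp. co-stable, sets under inclusion (meets are intersections, joins are Galois closures of unions, e.g. $\bigvee_iA_i={}^{\perp}((\bigcup_iA_i)^{\perp})$). For $W\subseteq X$ write $W'=W^\perp$, for $W\subseteq Y$ write $W'={}^\perp W$. Preorders: for $x,z\in X$, $x\leq z$ iff $\{x\}^{\perp}\subseteq\{z\}^{\perp}$; for $y,v\in Y$, $y\leq v$ iff ${}^{\perp}\{y\}\subseteq{}^{\perp}\{v\}$; the frame is separated if these are partial orders. $\Gamma u=\{w: u\leq w\}$ (same sort as $u$). For $C\subseteq X$ and $y\in Y$, $C\upharpoonleft y$ means $x\upharpoonleft y$ for all $x\in C$. For a ternary relation $T\subseteq Y\times X\times Y$ (written $yTxv$) its Galois dual $T'\subseteq X\times X\times Y$ is defined by $uT'xv$ iff for all $y\in Y$, $yTxv$ implies $u\upharpoonleft y$. An implicative frame is $(X,\upharpoonleft,Y,T)$ with $T\subseteq Y\times X\times Y$ such that: (F0) for all $x\in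 X,y\in Y$: $x\upharpoonleft y$ iff $uT'xy$ for all $u\in X$; (F1) the frame is separated; (F2) for all $x\in X,v\in Y$, the set $\{y\in Y: yTxv\}$ equals $\Gamma w$ for some $w\in Y$; (F3) for each $y\in Y$, if $yTxv$, $x_1\leq x$ and $v_1\leq v$ then $yTx_1v_1$; (F4) for all $z\in X$, $x\in X$, $v\in Y$, the sets $\{x_1\in X: zT'x_1v\}$ and $\{v_1\in Y: zT'xv_1\}$ are Galois sets (stable, resp. co-stable). For $A\in\mathcal{G}(X)$, $B\in\mathcal{G}(Y)$ let $A\blacktriangleright B=(\{y\in Y:\exists x\in A\,\exists v\in B\ yTxv\})''$, and for $A,C\in\mathcal{G}(X)$ let $A\Rightarrow C={}^{\perp}(A\blacktriangleright C^{\perp})$. -}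

module Defs where

open import Level using (0ℓ)
open import Data.Product using (Σ; ∃; _×_; _,_; proj₁; proj₂)
open import Relation.Unary using (Pred; _⊆_; _≐_; ⋃; ⋂)
open import Relation.Binary.PropositionalEquality using (_≡_)
open import Function.Bundles using (_⇔_)

-- Generic polarity operations, for a relation R ⊆ X × Y (x ↾ y written R x y).
module Polarity {X Y : Set} (R : X → Y → Set) where

  _⊥ : Pred X 0ℓ → Pred Y 0ℓ
  (U ⊥) y = ∀ x → U x → R x y

  ⊥_ : Pred Y 0ℓ → Pred X 0ℓ
  (⊥ V) x = ∀ y → V y → R x y

  Stable : Pred X 0ℓ → Set
  Stable A = A ≐ (⊥ (A ⊥))

  CoStable : Pred Y 0ℓ → Set
  CoStable B = B ≐ ((⊥ B) ⊥)

  _≤X_ : X → X → Set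
  x ≤X z = ∀ y → R x y → R z y

  _≤Y_ : Y → Y → Set
  y ≤Y v = ∀ x → R x y → R x v

  ΓX : X → Pred X 0ℓ
  ΓX u w = u ≤X w

  ΓY : Y → Pred Y 0ℓ
  ΓY u w = u ≤Y w

  ⟦_⟧X : X → Pred X 0ℓ
  ⟦ x ⟧X x' = x ≡ x'

  ⟦_⟧Y : Y → Pred Y 0ℓ
  ⟦ y ⟧Y y' = y ≡ y'

  _↾s_ : Pred X 0ℓ → Y → Set
  C ↾s y = ∀ x → C x → R x y

  Dual : (Y → X → Y → Set) → X → X → Y → Set
  Dual T u x v = ∀ y → T y x v → R u y

record ImplicativeFrame : Set₁ where
  field
    X : Set
    Y : Set
    R : X → Y → Set
    T : Y → X → Y → Set
    x₀ : X
    y₀ : Y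

  open Polarity R public

  T' : X → X → Y → Set
  T' = Dual T

  field
    F0 : ∀ x y → R x y ⇔ (∀ u → T' u x y)
    F1X : ∀ x z → x ≤X z → z ≤X x → x ≡ z
    F1Y : ∀ y v → y ≤Y v → v ≤Y y → y ≡ v
    F2 : ∀ x v → ∃ λ w → (λ y → T y x v) ≐ ΓY w
    F3 : ∀ y x v x₁ v₁ → T y x v → x₁ ≤X x → v₁ ≤Y v → T y x₁ v₁
    F4X : ∀ z v → Stable (λ x₁ → T' z x₁ v)
    F4Y : ∀ z x → CoStable (λ v₁ → T' z x v₁)

  _▶_ : Pred X 0ℓ → Pred Y 0ℓ → Pred Y 0ℓ
  A ▶ B = (⊥ (λ y → Σ X λ x → Σ Y λ v → A x × B v × T y x v)) ⊥

  _⇒_ : Pred X 0ℓ → Pred X 0ℓ → Pred X 0ℓ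
  A ⇒ C = ⊥ (A ▶ (C ⊥))

  ⋁ : (I : Set) → (I → Pred X 0ℓ) → Pred X 0ℓ
  ⋁ I A = ⊥ ((⋃ I A) ⊥)

{-# OPTIONS --safe #-}
-- Unfolding ▶, the set A ⇒ C is a triple polar ⊥((⊥S)⊥) = ⊥S, so u ∈ A ⇒ C says
-- precisely that u T' x y for all x ∈ A and y ∈ C^⊥. This is (4); (3) follows since
-- T' is monotone in both arguments (F3), (2) from (3) and (4), (5) from F0. For (1), the
-- sets {x | u T' x y} and {y | u T' x y} are Galois sets (F4), so the pointwise
-- condition passes from the A_i to their join and from the C_j^⊥ to (⋂ C_j)^⊥.
module Submission where

open import Defs
open import Level using (0ℓ)
open import Data.Product using (_×_; _,_; proj₁; proj₂)
open import Relation.Unary using (Pred; _⊆_; _≐_; ⋂; ⋃; U)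
open import Function.Bundles using (_⇔_; mk⇔; Equivalence)
open import Relation.Binary.PropositionalEquality using (refl)

module PolarityProperties {X Y : Set} (R : X → Y → Set) where
  open Polarity R

  ⊥-⊥-⊥ : (S : Pred Y 0ℓ) → ⊥ ((⊥ S) ⊥) ≐ ⊥ S
  ⊥-⊥-⊥ S = (λ h y s → h y (λ z hz → hz y s)) , (λ h y hy → hy _ h)

  join-least : ∀ {I} {A : I → Pred X 0ℓ} {S : Pred X 0ℓ} →
               Stable S → (∀ i → A i ⊆ S) → ⊥ ((⋃ I A) ⊥) ⊆ S
  join-least sS A⊆S hx = proj₂ sS (λ y hy → hx y (λ { x (i , ax) → hy x (A⊆S i ax) }))

  ⋂-⊥-least : ∀ {J} {C : J → Pred X 0ℓ} {S : Pred Y 0ℓ} →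
              CoStable S → (∀ j → Stable (C j)) → (∀ j → (C j) ⊥ ⊆ S) → (⋂ J C) ⊥ ⊆ S
  ⋂-⊥-least sS sC C⊥⊆S hy = proj₂ sS (λ x hx → hy x (λ j → proj₂ (sC j) (λ y cy → hx y (C⊥⊆S j cy))))

  ⊥⟦⟧-↾s⇒≤Y : ∀ {y y'} → (⊥ ⟦ y ⟧Y) ↾s y' → y ≤Y y'
  ⊥⟦⟧-↾s⇒≤Y h x rxy = h x (λ { _ refl → rxy })

module ImplicativeFrameProperties (F : ImplicativeFrame) where
  open ImplicativeFrame F
  open PolarityProperties R
  open Equivalence

  T'-mono : ∀ {u x x' y y'} → T' u x y → x ≤X x' → y ≤Y y' → T' u x' y'
  T'-mono {x = x} {x'} {y} {y'} t x≤x' y≤y' w twx'y' = t w (F3 w x' y' x y twx'y' x≤x' y≤y')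

  ⇒⇔T' : ∀ (A C : Pred X 0ℓ) u → (A ⇒ C) u ⇔ (∀ x y → A x → C ↾s y → T' u x y)
  ⇒⇔T' A C u = mk⇔
    (λ h x y ax cy w t → proj₁ (⊥-⊥-⊥ _) h w (x , y , ax , cy , t))
    (λ h → proj₂ (⊥-⊥-⊥ _) (λ { w (x , y , ax , cy , t) → h x y ax cy w t }))

  T'⇔principal-⇒ : ∀ u x y → T' u x y ⇔ (ΓX x ⇒ (⊥ ⟦ y ⟧Y)) u
  T'⇔principal-⇒ u x y = mk⇔
    (λ t → from (⇒⇔T' _ _ u) (λ x' y' x≤x' hy' → T'-mono t x≤x' (⊥⟦⟧-↾s⇒≤Y hy')))
    (λ h → to (⇒⇔T' _ _ u) h x y (λ _ rxz → rxz) (λ z hz → hz y refl))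

  ⇒-as-⋂-principal : ∀ (A C : Pred X 0ℓ) →
                     (A ⇒ C) ≐ (λ u → ∀ x y → A x → C ↾s y → (ΓX x ⇒ (⊥ ⟦ y ⟧Y)) u)
  ⇒-as-⋂-principal A C =
      (λ {u} h x y ax cy → to (T'⇔principal-⇒ u x y) (to (⇒⇔T' A C u) h x y ax cy))
    , (λ {u} h → from (⇒⇔T' A C u) (λ x y ax cy → from (T'⇔principal-⇒ u x y) (h x y ax cy)))

  ⊆⇔⇒-total : ∀ (A C : Pred X 0ℓ) → Stable C → (A ⊆ C) ⇔ (U ⊆ (A ⇒ C))
  ⊆⇔⇒-total A C sC = mk⇔
    (λ A⊆C {u} _ → from (⇒⇔T' A C u) (λ x y ax cy → to (F0 x y) (cy x (A⊆C ax)) u))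
    (λ total {x} ax → proj₂ sC (λ y cy → from (F0 x y) (λ u → to (⇒⇔T' A C u) (total _) x y ax cy)))

  ⋁-⇒-⋂ : ∀ (I J : Set) (A : I → Pred X 0ℓ) (C : J → Pred X 0ℓ) → (∀ j → Stable (C j)) →
          (⋁ I A ⇒ ⋂ J C) ≐ ⋂ (I × J) (λ { (i , j) → A i ⇒ C j })
  ⋁-⇒-⋂ I J A C sC = ⊆-⋂ , ⋂-⊆
    where
    ⊆-⋂ : (⋁ I A ⇒ ⋂ J C) ⊆ ⋂ (I × J) (λ { (i , j) → A i ⇒ C j })
    ⊆-⋂ {u} h (i , j) = from (⇒⇔T' (A i) (C j) u) (λ x y ax cy →
      to (⇒⇔T' (⋁ I A) (⋂ J C) u) h x y (λ w hw → hw x (i , ax)) (λ z hz → cy z (hz j)))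

    ⋂-⊆ : ⋂ (I × J) (λ { (i , j) → A i ⇒ C j }) ⊆ (⋁ I A ⇒ ⋂ J C)
    ⋂-⊆ {u} h = from (⇒⇔T' (⋁ I A) (⋂ J C) u) (λ x y hx hy →
        join-least {S = λ x' → T' u x' y} (F4X u y)
          (λ i {x'} ax' → ⋂-⊥-least (F4Y u x') sC
             (λ j cy' → to (⇒⇔T' (A i) (C j) u) (h (i , j)) x' _ ax' cy') hy)
          hx)

proposition3p6 : (F : ImplicativeFrame) → let open ImplicativeFrame F in
    -- (1)
    (∀ (I J : Set) (A : I → Pred X 0ℓ) (C : J → Pred X 0ℓ) →
       (∀ i → Stable (A i)) → (∀ j → Stable (C j)) →
       (⋁ I A ⇒ ⋂ J C) ≐ ⋂ (I × J) (λ { (i , j) → A i ⇒ C j }))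
    × -- (2)
    (∀ (A C : Pred X 0ℓ) → Stable A → Stable C →
       (A ⇒ C) ≐ (λ u → ∀ x y → A x → C ↾s y → (ΓX x ⇒ (⊥ ⟦ y ⟧Y)) u))
    × -- (3)
    (∀ u x y → T' u x y ⇔ (ΓX x ⇒ (⊥ ⟦ y ⟧Y)) u)
    × -- (4)
    (∀ (A C : Pred X 0ℓ) → Stable A → Stable C → ∀ u →
       (A ⇒ C) u ⇔ (∀ x y → A x → C ↾s y → T' u x y))
    × -- (5)
    (∀ (A C : Pred X 0ℓ) → Stable A → Stable C →
       (A ⊆ C) ⇔ (U ⊆ (A ⇒ C)))
proposition3p6 F =
    (λ I J A C _ sC → ⋁-⇒-⋂ I J A C sC)
  , (λ A C _ _ → ⇒-as-⋂-principal A C)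
  , T'⇔principal-⇒
  , (λ A C _ _ → ⇒⇔T' A C)
  , (λ A C _ sC → ⊆⇔⇒-total A C sC)
  where open ImplicativeFrameProperties F
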